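{- Let $p\geq2$ be a prime, $n\geq1$, and let $l=\max\{t:\ p^t\leq s_p(n)\}$, so that $p^l\leq s_p(n)<p^{l+1}$. Let $k=p^{l+m}x$ with integers $m\geq1$, $x\geq1$, and suppose $k>s_p(n)$. Then \[ \frac{1}{p-1}\big(s_p(j_1)+\dots+s_p(j_k)-s_p(n)\big)\geq m \] for all positive integers $j_1,\dots,j_k$ with $j_1+\dots+j_k=n$.
   Context: For a positive integer $m'$ with base-$p$ expansion $m'=\alpha_0+\alpha_1p+\dots+\alpha_rp^r$ ($0\le\alpha_i\le p-1$), $s_p(m')=\alpha_0+\dots+\alpha_r$ denotes its base-$p$ digit sum. -}

module Defs where

open import Data.Nat using (ℕ; zero; suc; _+_; NonZero)
open import Data.Nat.DivMod using (_/_; _%_)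

-- base-p digit sum with fuel: digits processed while fuel lasts.
-- Fuel m suffices for input m whenever p ≥ 2 (each step divides by p).
digitSumFuel : (p : ℕ) .{{_ : NonZero p}} → ℕ → ℕ → ℕ
digitSumFuel p zero    m = 0
digitSumFuel p (suc f) zero = 0
digitSumFuel p (suc f) m@(suc _) = m % p + digitSumFuel p f (m / p)

s : (p : ℕ) .{{_ : NonZero p}} → ℕ → ℕ
s p m = digitSumFuel p m m

open import Data.Fin using (Fin)
open import Data.Vec.Functional using (foldr)

sumFin : {k : ℕ} → (Fin k → ℕ) → ℕ
sumFin j = foldr _+_ 0 j

{-# OPTIONS --safe #-}
module Submission where

-- A number is congruent to its base-p digit sum modulo p − 1, so the sum T of the s_p(j_i)
-- is congruent to s_p(n) modulo p − 1.  Each s_p(j_i) is at least 1, hence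
-- T ≥ k ≥ p^(l+m) ≥ p^(l+1) + (m − 1)(p − 1) > s_p(n) + (m − 1)(p − 1),
-- and the congruence pushes T up to s_p(n) + m(p − 1).

open import Defs
open import Data.Nat using (ℕ; zero; suc; _+_; _*_; _∸_; _^_; _≤_; _<_; NonZero; >-nonZero; z≤n; s≤s; _<?_)
open import Data.Nat.Properties
open import Data.Nat.DivMod using (_/_; _%_; m≡m%n+[m/n]*n; m/n<m; m<n⇒m%n≡m; m≥n⇒m/n>0)
open import Data.Nat.Primality using (Prime; prime⇒nonTrivial)
open import Data.Nat.Base using (nonTrivial⇒n>1)
open import Data.Fin using (Fin) renaming (zero to fzero; suc to fsuc)
open import Data.Vec.Functional using (map)
open import Data.Product using (∃₂; _,_)
open import Relation.Nullary using (yes; no; contradiction)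
open import Relation.Binary.PropositionalEquality using (_≡_; refl; sym; trans; cong; cong₂; subst)
open import Function using (_∘_)
open import Data.Nat.Solver using (module +-*-Solver)
open +-*-Solver using (solve; _:+_; _:*_; _:=_)

infix 4 _≡_mod_

_≡_mod_ : ℕ → ℕ → ℕ → Set
_≡_mod_ a b q = ∃₂ λ c d → a + c * q ≡ b + d * q

≡-mod-reflexive : ∀ {a b q} → a ≡ b → a ≡ b mod q
≡-mod-reflexive refl = 0 , 0 , refl

≡-mod-sym : ∀ {a b q} → a ≡ b mod q → b ≡ a mod q
≡-mod-sym (c , d , eq) = d , c , sym eq

≡-mod-trans : ∀ {a b e q} → a ≡ b mod q → b ≡ e mod q → a ≡ e mod q
≡-mod-trans {a} {b} {e} {q} (c , d , ab) (c′ , d′ , be) = c + c′ , d + d′ , (begin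
  a + (c + c′) * q       ≡⟨ shuffle a c c′ q ⟩
  (a + c * q) + c′ * q   ≡⟨ cong (_+ c′ * q) ab ⟩
  (b + d * q) + c′ * q   ≡⟨ shuffle′ b d c′ q ⟩
  (b + c′ * q) + d * q   ≡⟨ cong (_+ d * q) be ⟩
  (e + d′ * q) + d * q   ≡⟨ shuffle″ e d′ d q ⟩
  e + (d + d′) * q       ∎)
  where
  open Relation.Binary.PropositionalEquality.≡-Reasoning
  shuffle : ∀ a c c′ q → a + (c + c′) * q ≡ (a + c * q) + c′ * q
  shuffle = solve 4 (λ a c c′ q → a :+ (c :+ c′) :* q := (a :+ c :* q) :+ c′ :* q) refl
  shuffle′ : ∀ b d c′ q → (b + d * q) + c′ * q ≡ (b + c′ * q) + d * q
  shuffle′ = solve 4 (λ b d c′ q → (b :+ d :* q) :+ c′ :* q := (b :+ c′ :* q) :+ d :* q) refl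
  shuffle″ : ∀ e d′ d q → (e + d′ * q) + d * q ≡ e + (d + d′) * q
  shuffle″ = solve 4 (λ e d′ d q → (e :+ d′ :* q) :+ d :* q := e :+ (d :+ d′) :* q) refl

+-cong-≡-mod : ∀ {a b c d q} → a ≡ b mod q → c ≡ d mod q → a + c ≡ b + d mod q
+-cong-≡-mod {a} {b} {c} {d} {q} (u , v , ab) (u′ , v′ , cd) = u + u′ , v + v′ , (begin
  a + c + (u + u′) * q           ≡⟨ interchange a c u u′ q ⟩
  (a + u * q) + (c + u′ * q)     ≡⟨ cong₂ _+_ ab cd ⟩
  (b + v * q) + (d + v′ * q)     ≡⟨ sym (interchange b d v v′ q) ⟩
  b + d + (v + v′) * q           ∎)
  where
  open Relation.Binary.PropositionalEquality.≡-Reasoning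
  interchange : ∀ a c u u′ q → a + c + (u + u′) * q ≡ (a + u * q) + (c + u′ * q)
  interchange = solve 5 (λ a c u u′ q → a :+ c :+ (u :+ u′) :* q := (a :+ u :* q) :+ (c :+ u′ :* q)) refl

*-≡-mod-pred : ∀ a p .{{_ : NonZero p}} → a * p ≡ a mod p ∸ 1
*-≡-mod-pred a (suc q) = 0 , a , trans (+-identityʳ (a * suc q)) (*-suc a q)

+-*-≡-mod : ∀ a m q → a + m * q ≡ a mod q
+-*-≡-mod a m q = 0 , m , +-identityʳ (a + m * q)

≡-mod-<⇒+≤ : ∀ {a b q} → a ≡ b mod q → b < a → b + q ≤ a
≡-mod-<⇒+≤ {a} {b} {q} (c , d , eq) b<a with c <? d
... | yes c<d = +-cancelʳ-≤ (c * q) (b + q) a (begin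
  b + q + c * q      ≡⟨ +-assoc b q (c * q) ⟩
  b + suc c * q      ≤⟨ +-monoʳ-≤ b (*-monoˡ-≤ q c<d) ⟩
  b + d * q          ≡⟨ sym eq ⟩
  a + c * q          ∎)
  where open ≤-Reasoning
... | no c≮d = contradiction (begin-strict
  b + d * q          ≤⟨ +-monoʳ-≤ b (*-monoˡ-≤ q (≮⇒≥ c≮d)) ⟩
  b + c * q          <⟨ +-monoˡ-< (c * q) b<a ⟩
  a + c * q          ≡⟨ eq ⟩
  b + d * q          ∎) (<-irrefl refl)
  where open ≤-Reasoning

sumFin-cong-≡-mod : ∀ {k q} (j t : Fin k → ℕ) → (∀ i → j i ≡ t i mod q) →
                    sumFin j ≡ sumFin t mod q
sumFin-cong-≡-mod {zero}  j t j≡t = ≡-mod-reflexive refl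
sumFin-cong-≡-mod {suc k} j t j≡t =
  +-cong-≡-mod (j≡t fzero) (sumFin-cong-≡-mod (j ∘ fsuc) (t ∘ fsuc) (j≡t ∘ fsuc))

all-positive⇒k≤sumFin : ∀ {k} (t : Fin k → ℕ) → (∀ i → 1 ≤ t i) → k ≤ sumFin t
all-positive⇒k≤sumFin {zero}  t t≥1 = z≤n
all-positive⇒k≤sumFin {suc k} t t≥1 =
  +-mono-≤ (t≥1 fzero) (all-positive⇒k≤sumFin (t ∘ fsuc) (t≥1 ∘ fsuc))

p^a+m[p∸1]≤p^[a+m] : ∀ p .{{_ : NonZero p}} a m → p ^ a + m * (p ∸ 1) ≤ p ^ (a + m)
p^a+m[p∸1]≤p^[a+m] p a zero = ≤-reflexive (trans (+-identityʳ (p ^ a)) (cong (p ^_) (sym (+-identityʳ a))))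
p^a+m[p∸1]≤p^[a+m] (suc q) a (suc m) = begin
  P ^ a + (q + m * q)     ≡⟨ +-comm (P ^ a) (q + m * q) ⟩
  q + m * q + P ^ a       ≡⟨ +-assoc q (m * q) (P ^ a) ⟩
  q + (m * q + P ^ a)     ≡⟨ cong (q +_) (+-comm (m * q) (P ^ a)) ⟩
  q + (P ^ a + m * q)     ≤⟨ +-monoʳ-≤ q (p^a+m[p∸1]≤p^[a+m] P a m) ⟩
  q + Y                   ≤⟨ +-monoˡ-≤ Y (m≤m*n q Y {{>-nonZero (m^n>0 P (a + m))}}) ⟩
  q * Y + Y               ≡⟨ +-comm (q * Y) Y ⟩
  P ^ suc (a + m)         ≡⟨ cong (P ^_) (sym (+-suc a m)) ⟩
  P ^ (a + suc m)         ∎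
  where
  open ≤-Reasoning
  P Y : ℕ
  P = suc q
  Y = P ^ (a + m)

module _ (p : ℕ) .{{_ : NonZero p}} (1<p : 1 < p) where

  private
    m/p≤ : ∀ {m f} .{{_ : NonZero m}} → m ≤ suc f → m / p ≤ f
    m/p≤ {m} m≤sf = <⇒≤pred (≤-trans (m/n<m m p 1<p) m≤sf)

  digitSumFuel-≡-mod : ∀ f m → m ≤ f → m ≡ digitSumFuel p f m mod p ∸ 1
  digitSumFuel-≡-mod zero    zero    _ = ≡-mod-reflexive refl
  digitSumFuel-≡-mod (suc f) zero    _ = ≡-mod-reflexive refl
  digitSumFuel-≡-mod (suc f) m@(suc _) m≤sf =
    ≡-mod-trans (≡-mod-reflexive (m≡m%n+[m/n]*n m p))
      (+-cong-≡-mod (≡-mod-reflexive refl)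
        (≡-mod-trans (*-≡-mod-pred (m / p) p) (digitSumFuel-≡-mod f (m / p) (m/p≤ m≤sf))))

  s-≡-mod : ∀ m → m ≡ s p m mod p ∸ 1
  s-≡-mod m = digitSumFuel-≡-mod m m ≤-refl

  digitSumFuel-positive : ∀ f m → 1 ≤ m → m ≤ f → 1 ≤ digitSumFuel p f m
  digitSumFuel-positive (suc f) m@(suc _) _ m≤sf with m <? p
  ... | yes m<p = ≤-trans (subst (1 ≤_) (sym (m<n⇒m%n≡m m<p)) (s≤s z≤n)) (m≤m+n (m % p) _)
  ... | no m≮p = ≤-trans
          (digitSumFuel-positive f (m / p) (m≥n⇒m/n>0 (≮⇒≥ m≮p)) (m/p≤ m≤sf))
          (m≤n+m _ (m % p))

  s-positive : ∀ {m} → 1 ≤ m → 1 ≤ s p m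
  s-positive {m} m≥1 = digitSumFuel-positive m m m≥1 ≤-refl

lemma3 : (p : ℕ) .{{_ : NonZero p}} → Prime p → (n : ℕ) → 1 ≤ n →
         (l : ℕ) → p ^ l ≤ s p n → s p n < p ^ (l + 1) →
         (m x : ℕ) → 1 ≤ m → 1 ≤ x →
         (k : ℕ) → k ≡ p ^ (l + m) * x → s p n < k →
         (j : Fin k → ℕ) → (∀ i → 1 ≤ j i) → sumFin j ≡ n →
         s p n + m * (p ∸ 1) ≤ sumFin (map (s p) j)
lemma3 p pp n _ l _ S<p^[l+1] (suc m) x _ x≥1 k refl _ j j≥1 Σj≡n =
  subst (_≤ T) (trans (+-assoc S (m * q) q) (cong (S +_) (+-comm (m * q) q)))
        (≡-mod-<⇒+≤ T≡S+mq S+mq<T)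
  where
  1<p : 1 < p
  1<p = nonTrivial⇒n>1 p {{prime⇒nonTrivial pp}}
  q S T : ℕ
  q = p ∸ 1
  S = s p n
  T = sumFin (map (s p) j)
  T≡S+mq : T ≡ S + m * q mod q
  T≡S+mq = ≡-mod-trans (≡-mod-sym (sumFin-cong-≡-mod j (map (s p) j) (s-≡-mod p 1<p ∘ j)))
           (≡-mod-trans (≡-mod-reflexive Σj≡n)
           (≡-mod-trans (s-≡-mod p 1<p n)
                        (≡-mod-sym (+-*-≡-mod S m q))))
  S+mq<T : S + m * q < T
  S+mq<T = begin-strict
    S + m * q                   <⟨ +-monoˡ-< (m * q) S<p^[l+1] ⟩
    p ^ (l + 1) + m * q         ≤⟨ p^a+m[p∸1]≤p^[a+m] p (l + 1) m ⟩
    p ^ (l + 1 + m)             ≡⟨ cong (p ^_) (+-assoc l 1 m) ⟩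
    p ^ (l + suc m)             ≤⟨ m≤m*n _ x {{>-nonZero x≥1}} ⟩
    p ^ (l + suc m) * x         ≤⟨ all-positive⇒k≤sumFin (map (s p) j) (s-positive p 1<p ∘ j≥1) ⟩
    T                           ∎
    where open ≤-Reasoning
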